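{- (1) If $(\Gamma,\Omega,\Delta)\vdash M\Uparrow N:A$ and $\Gamma;\Omega;\Delta\vdash M:A$, then $\Gamma;\Omega;\Delta\vdash N\Uparrow A$. (2) If $(\Gamma,\Omega,\Delta)\vdash M\downarrow N:A$ and $\Gamma;\Omega;\Delta\vdash M:A$, then $\Gamma;\Omega;\Delta\vdash N\downarrow A$.
   Context: Strict $\lambda$-calculus over a signature $\Sigma$. Labels $k\in\{1,0,u\}$; types $A::=a\mid A_1\to^kA_2$; terms $c\mid x\mid\lambda x^k{:}A.M\mid M_1M_2^k$; $[N/x]M$ capture-avoiding substitution. Contexts: finite sets of declarations with distinct variables; commas denote disjoint union. Typing $\Gamma;\Omega;\Delta\vdash M:A$ (unrestricted, irrelevant, strict; disjoint): if $c{:}A\in\Sigma$ then $\Gamma;\Omega;\cdot\vdash c:A$; $(\Gamma,x{:}A);\Omega;\cdot\vdash x:A$; $\Gamma;\Omega;x{:}A\vdash x:A$ (no rule for $\Omega$); from $(\Gamma,x{:}A);\Omega;\Delta\vdash M:B$ infer $\Gamma;\Omega;\Delta\vdash\lambda x^u{:}A.M:A\to^uB$; from $\Gamma;(\Omega,x{:}A);\Delta\vdash M:B$ infer $\lambda x^0{:}A.M:A\to^0B$; from $\Gamma;\Omega;(\Delta,x{:}A)\vdash M:B$ infer $\lambda x^1{:}A.M:A\to^1B$; from $\Gamma;\Omega;\Delta\vdash M:A\to^uB$ and $(\Gamma,\Delta);\Omega;\cdot\vdash N:A$ infer $\Gamma;\Omega;\Delta\vdash MN^u:B$; from $\Gamma;\Omega;\Delta\vdash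 M:A\to^0B$ and $(\Gamma,\Omega,\Delta);\cdot;\cdot\vdash N:A$ infer $\Gamma;\Omega;\Delta\vdash MN^0:B$; from $(\Gamma,\Delta_N);\Omega;\Delta_M\vdash M:A\to^1B$ and $(\Gamma,\Delta_M);\Omega;\Delta_N\vdash N:A$ infer $\Gamma;\Omega;(\Delta_M,\Delta_N)\vdash MN^1:B$. Canonical/atomic forms $\Gamma;\Omega;\Delta\vdash M\Uparrow A$, $\Gamma;\Omega;\Delta\vdash M\downarrow A$: $c{:}A\in\Sigma$ gives $\Gamma;\Omega;\cdot\vdash c\downarrow A$; $(\Gamma,x{:}A);\Omega;\cdot\vdash x\downarrow A$; $\Gamma;\Omega;x{:}A\vdash x\downarrow A$; $M\downarrow a$ ($a$ atomic) gives $M\Uparrow a$; the three $\lambda$ rules as for typing with $\Uparrow$ in premise and conclusion; the three application rules as for typing with function premise and conclusion in $\downarrow$ and argument premise in $\Uparrow$. Conversion: $(\lambda x^k{:}A.M)N^k\to_{whr}[N/x]M$; $M\to_{whr}Q$ implies $MN^k\to_{whr}QN^k$. For a single context $\Psi$: $c{:}A\in\Sigma$ gives $\Psi\vdash c\downarrow c:A$; $x{:}A\in\Psi$ gives $\Psi\vdash x\downarrow x:A$; if $M\to_{whr}M'$ and $\Psi\vdash M'\Uparrow M'':a$ then $\Psi\vdash M\Uparrow M'':a$; if $\Psi\vdash M\downarrow N:a$ then $\Psi\vdash M\Uparrow N:a$; if $(\Psi,x{:}A)\vdash Mx^k\Uparrow N:B$ ($x$ fresh) then $\Psi\vdash M\Uparrow\lambda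 x^k{:}A.N:A\to^kB$; if $\Psi\vdash M\downarrow P:A\to^kB$ and $\Psi\vdash N\Uparrow Q:A$ then $\Psi\vdash MN^k\downarrow PQ^k:B$. -}

module Defs where

open import Data.Nat using (ℕ; suc)
open import Data.Fin using (Fin; zero; suc; _≟_)
open import Data.Vec using (Vec; []; _∷_; lookup; map)
open import Data.Product using (_×_; _,_; proj₁; proj₂)
open import Data.Maybe using (Maybe; just)
open import Relation.Binary.PropositionalEquality using (_≡_; _≢_)

data Lbl : Set where
  l1 : Lbl
  l0 : Lbl
  lu : Lbl

infixr 7 _⟶[_]_
data Ty : Set where
  base   : ℕ → Ty
  _⟶[_]_ : Ty → Lbl → Ty → Ty

-- Terms (well-scoped de Bruijn; constants named by ℕ)
--   lam k A M  is  λx^k:A.M ,   app M N k  is  M N^k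

data Tm (n : ℕ) : Set where
  con : ℕ → Tm n
  var : Fin n → Tm n
  lam : Lbl → Ty → Tm (suc n) → Tm n
  app : Tm n → Tm n → Lbl → Tm n

-- A signature Σ: a partial assignment of types to constants
-- (a finite or infinite set of declarations c:A with distinct c).
Sig : Set
Sig = ℕ → Maybe Ty

Ren : ℕ → ℕ → Set
Ren m n = Fin m → Fin n

extR : ∀ {m n} → Ren m n → Ren (suc m) (suc n)
extR ρ zero    = zero
extR ρ (suc i) = suc (ρ i)

ren : ∀ {m n} → Ren m n → Tm m → Tm n
ren ρ (con c)     = con c
ren ρ (var i)     = var (ρ i)
ren ρ (lam k A M) = lam k A (ren (extR ρ) M)
ren ρ (app M N k) = app (ren ρ M) (ren ρ N) k

weaken : ∀ {n} → Tm n → Tm (suc n)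
weaken = ren suc

Subst : ℕ → ℕ → Set
Subst m n = Fin m → Tm n

extS : ∀ {m n} → Subst m n → Subst (suc m) (suc n)
extS σ zero    = var zero
extS σ (suc i) = weaken (σ i)

sub : ∀ {m n} → Subst m n → Tm m → Tm n
sub σ (con c)     = con c
sub σ (var i)     = σ i
sub σ (lam k A M) = lam k A (sub (extS σ) M)
sub σ (app M N k) = app (sub σ M) (sub σ N) k

single : ∀ {n} → Tm n → Subst (suc n) n
single N zero    = N
single N (suc i) = var i

_[_] : ∀ {n} → Tm (suc n) → Tm n → Tm n
M [ N ] = sub (single N) M

-- A context is a sequence of declarations, each tagged with the zone it
-- belongs to:  lu = Γ (unrestricted), l0 = Ω (irrelevant), l1 = Δ (strict).
-- Variables are distinct by construction (de Bruijn positions), and the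
-- three zones are disjoint.

Ctx : ℕ → Set
Ctx n = Vec (Lbl × Ty) n

-- the joined single context (Γ,Ω,Δ)
erase : ∀ {n} → Ctx n → Vec Ty n
erase = map proj₂

NoStrict : ∀ {n} → Ctx n → Set
NoStrict {n} Ψ = (j : Fin n) → proj₁ (lookup Ψ j) ≢ l1

-- Δ = x:A, i.e. the only strict declaration is at position i
OnlyStrict : ∀ {n} → Fin n → Ctx n → Set
OnlyStrict {n} i Ψ = (j : Fin n) → j ≢ i → proj₁ (lookup Ψ j) ≢ l1

-- (Γ,Δ);Ω;·   : strict declarations become unrestricted
strictToU : Lbl → Lbl
strictToU l1 = lu
strictToU l0 = l0
strictToU lu = lu

moveΔtoΓ : ∀ {n} → Ctx n → Ctx n
moveΔtoΓ = map (λ { (k , A) → strictToU k , A })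

-- (Γ,Ω,Δ);·;·  : everything becomes unrestricted
allToΓ : ∀ {n} → Ctx n → Ctx n
allToΓ = map (λ { (k , A) → lu , A })

-- Split Ψ ΨM ΨN : Ψ = Γ;Ω;(Δ_M,Δ_N),
--   ΨM = (Γ,Δ_N);Ω;Δ_M  and  ΨN = (Γ,Δ_M);Ω;Δ_N
data Split : ∀ {n} → Ctx n → Ctx n → Ctx n → Set where
  []    : Split [] [] []
  sU    : ∀ {n A} {Ψ ΨM ΨN : Ctx n} → Split Ψ ΨM ΨN →
          Split ((lu , A) ∷ Ψ) ((lu , A) ∷ ΨM) ((lu , A) ∷ ΨN)
  s0    : ∀ {n A} {Ψ ΨM ΨN : Ctx n} → Split Ψ ΨM ΨN →
          Split ((l0 , A) ∷ Ψ) ((l0 , A) ∷ ΨM) ((l0 , A) ∷ ΨN)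
  sLeft : ∀ {n A} {Ψ ΨM ΨN : Ctx n} → Split Ψ ΨM ΨN →
          Split ((l1 , A) ∷ Ψ) ((l1 , A) ∷ ΨM) ((lu , A) ∷ ΨN)
  sRight : ∀ {n A} {Ψ ΨM ΨN : Ctx n} → Split Ψ ΨM ΨN →
          Split ((l1 , A) ∷ Ψ) ((lu , A) ∷ ΨM) ((l1 , A) ∷ ΨN)

infix 4 _∣_⊢_∶_ _∣_⊢_⇑_ _∣_⊢_↓_ _∣_⊩_⇑_∶_ _∣_⊩_↓_∶_

-- Typing  Γ;Ω;Δ ⊢ M : A   written   Σ ∣ Ψ ⊢ M ∶ A

data _∣_⊢_∶_ (Σ : Sig) {n : ℕ} : Ctx n → Tm n → Ty → Set where
  t-con  : ∀ {Ψ c A} → Σ c ≡ just A → NoStrict Ψ → Σ ∣ Ψ ⊢ con c ∶ A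
  t-varU : ∀ {Ψ i A} → lookup Ψ i ≡ (lu , A) → NoStrict Ψ →
           Σ ∣ Ψ ⊢ var i ∶ A
  t-varS : ∀ {Ψ i A} → lookup Ψ i ≡ (l1 , A) → OnlyStrict i Ψ →
           Σ ∣ Ψ ⊢ var i ∶ A
  t-lamU : ∀ {Ψ A B M} → Σ ∣ ((lu , A) ∷ Ψ) ⊢ M ∶ B →
           Σ ∣ Ψ ⊢ lam lu A M ∶ A ⟶[ lu ] B
  t-lam0 : ∀ {Ψ A B M} → Σ ∣ ((l0 , A) ∷ Ψ) ⊢ M ∶ B →
           Σ ∣ Ψ ⊢ lam l0 A M ∶ A ⟶[ l0 ] B
  t-lam1 : ∀ {Ψ A B M} → Σ ∣ ((l1 , A) ∷ Ψ) ⊢ M ∶ B →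
           Σ ∣ Ψ ⊢ lam l1 A M ∶ A ⟶[ l1 ] B
  t-appU : ∀ {Ψ A B M N} → Σ ∣ Ψ ⊢ M ∶ A ⟶[ lu ] B →
           Σ ∣ moveΔtoΓ Ψ ⊢ N ∶ A → Σ ∣ Ψ ⊢ app M N lu ∶ B
  t-app0 : ∀ {Ψ A B M N} → Σ ∣ Ψ ⊢ M ∶ A ⟶[ l0 ] B →
           Σ ∣ allToΓ Ψ ⊢ N ∶ A → Σ ∣ Ψ ⊢ app M N l0 ∶ B
  t-app1 : ∀ {Ψ ΨM ΨN A B M N} → Split Ψ ΨM ΨN →
           Σ ∣ ΨM ⊢ M ∶ A ⟶[ l1 ] B → Σ ∣ ΨN ⊢ N ∶ A →
           Σ ∣ Ψ ⊢ app M N l1 ∶ B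

data _∣_⊢_⇑_ (Σ : Sig) {n : ℕ} : Ctx n → Tm n → Ty → Set
data _∣_⊢_↓_ (Σ : Sig) {n : ℕ} : Ctx n → Tm n → Ty → Set

data _∣_⊢_⇑_ Σ where
  c-atm  : ∀ {Ψ M a} → Σ ∣ Ψ ⊢ M ↓ base a → Σ ∣ Ψ ⊢ M ⇑ base a
  c-lamU : ∀ {Ψ A B M} → Σ ∣ ((lu , A) ∷ Ψ) ⊢ M ⇑ B →
           Σ ∣ Ψ ⊢ lam lu A M ⇑ A ⟶[ lu ] B
  c-lam0 : ∀ {Ψ A B M} → Σ ∣ ((l0 , A) ∷ Ψ) ⊢ M ⇑ B →
           Σ ∣ Ψ ⊢ lam l0 A M ⇑ A ⟶[ l0 ] B
  c-lam1 : ∀ {Ψ A B M} → Σ ∣ ((l1 , A) ∷ Ψ) ⊢ M ⇑ B →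
           Σ ∣ Ψ ⊢ lam l1 A M ⇑ A ⟶[ l1 ] B

data _∣_⊢_↓_ Σ where
  a-con  : ∀ {Ψ c A} → Σ c ≡ just A → NoStrict Ψ → Σ ∣ Ψ ⊢ con c ↓ A
  a-varU : ∀ {Ψ i A} → lookup Ψ i ≡ (lu , A) → NoStrict Ψ →
           Σ ∣ Ψ ⊢ var i ↓ A
  a-varS : ∀ {Ψ i A} → lookup Ψ i ≡ (l1 , A) → OnlyStrict i Ψ →
           Σ ∣ Ψ ⊢ var i ↓ A
  a-appU : ∀ {Ψ A B M N} → Σ ∣ Ψ ⊢ M ↓ A ⟶[ lu ] B →
           Σ ∣ moveΔtoΓ Ψ ⊢ N ⇑ A → Σ ∣ Ψ ⊢ app M N lu ↓ B
  a-app0 : ∀ {Ψ A B M N} → Σ ∣ Ψ ⊢ M ↓ A ⟶[ l0 ] B →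
           Σ ∣ allToΓ Ψ ⊢ N ⇑ A → Σ ∣ Ψ ⊢ app M N l0 ↓ B
  a-app1 : ∀ {Ψ ΨM ΨN A B M N} → Split Ψ ΨM ΨN →
           Σ ∣ ΨM ⊢ M ↓ A ⟶[ l1 ] B → Σ ∣ ΨN ⊢ N ⇑ A →
           Σ ∣ Ψ ⊢ app M N l1 ↓ B

data _⟶whr_ {n : ℕ} : Tm n → Tm n → Set where
  whr-β   : ∀ {k A M N} → app (lam k A M) N k ⟶whr (M [ N ])
  whr-app : ∀ {k M Q N} → M ⟶whr Q → app M N k ⟶whr app Q N k

data _∣_⊩_⇑_∶_ (Σ : Sig) {n : ℕ} : Vec Ty n → Tm n → Tm n → Ty → Set
data _∣_⊩_↓_∶_ (Σ : Sig) {n : ℕ} : Vec Ty n → Tm n → Tm n → Ty → Set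

data _∣_⊩_⇑_∶_ Σ where
  cv-whr : ∀ {Ψ M M′ M″ a} → M ⟶whr M′ → Σ ∣ Ψ ⊩ M′ ⇑ M″ ∶ base a →
           Σ ∣ Ψ ⊩ M ⇑ M″ ∶ base a
  cv-atm : ∀ {Ψ M N a} → Σ ∣ Ψ ⊩ M ↓ N ∶ base a → Σ ∣ Ψ ⊩ M ⇑ N ∶ base a
  cv-lam : ∀ {Ψ M N A B k} →
           Σ ∣ (A ∷ Ψ) ⊩ app (weaken M) (var zero) k ⇑ N ∶ B →
           Σ ∣ Ψ ⊩ M ⇑ lam k A N ∶ A ⟶[ k ] B

data _∣_⊩_↓_∶_ Σ where
  cv-con : ∀ {Ψ c A} → Σ c ≡ just A → Σ ∣ Ψ ⊩ con c ↓ con c ∶ A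
  cv-var : ∀ {Ψ i A} → lookup Ψ i ≡ A → Σ ∣ Ψ ⊩ var i ↓ var i ∶ A
  cv-app : ∀ {Ψ M P N Q A B k} → Σ ∣ Ψ ⊩ M ↓ P ∶ A ⟶[ k ] B →
           Σ ∣ Ψ ⊩ N ⇑ Q ∶ A → Σ ∣ Ψ ⊩ app M N k ↓ app P Q k ∶ B

{-# OPTIONS --safe #-}
module Submission where

-- Induction on the conversion derivation, carrying the typing derivation along. Weak head
-- reduction is the only step that changes the term, so the core is subject reduction: one
-- substitution lemma per label, resting on weakening and on relabelling strict or irrelevant
-- variables as unrestricted (which is how the argument contexts (Γ,Δ);Ω;· and (Γ,Ω,Δ);·;· arise).
-- In the η-step the fresh variable is declared with the label of the arrow. In an application,
-- atomic conversion determines the type of the head, so the domain it yields is the one in the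
-- typing derivation and the typing of the argument can be reused.

open import Defs
open import Data.Nat using (ℕ; suc)
open import Data.Fin using (Fin; zero; suc; punchIn; _≟_)
open import Data.Fin.Properties using (punchInᵢ≢i; punchIn-injective; suc-injective)
open import Data.Vec using (Vec; []; _∷_; lookup; map)
open import Data.Vec.Properties using (map-∘; map-cong; lookup-map)
open import Data.Maybe.Properties using (just-injective)
open import Data.Product using (_×_; _,_; proj₁; proj₂; ∃-syntax)
open import Data.Empty using (⊥; ⊥-elim)
open import Relation.Nullary using (yes; no)
open import Relation.Binary.PropositionalEquality
  using (_≡_; _≢_; refl; sym; trans; cong; cong₂; subst)

private variable
  m n : ℕ
  k k′ : Lbl
  A B : Ty
  x y : Lbl × Ty
  i : Fin n
  p : Fin (suc n)
  Φ : Ctx m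
  Θ ΘM ΘN Ψ Ψ′ ΨM ΨN : Ctx n
  Ξ ΞM ΞN : Ctx (suc n)
  M M′ N : Tm n
  σ : Subst m n
  G : Vec Ty n

data _≤ˡ_ : Lbl → Lbl → Set where
  ≤ˡ-refl : k ≤ˡ k
  1≤ˡu    : l1 ≤ˡ lu
  0≤ˡu    : l0 ≤ˡ lu

≤ˡ-lu : ∀ k → k ≤ˡ lu
≤ˡ-lu l1 = 1≤ˡu
≤ˡ-lu l0 = 0≤ˡu
≤ˡ-lu lu = ≤ˡ-refl

≤ˡ-nonstrict : k ≤ˡ k′ → k ≢ l1 → k′ ≢ l1
≤ˡ-nonstrict ≤ˡ-refl k≢l1 = k≢l1
≤ˡ-nonstrict 1≤ˡu    _    = λ ()
≤ˡ-nonstrict 0≤ˡu    _    = λ ()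

strictToU-nonstrict : ∀ k → strictToU k ≢ l1
strictToU-nonstrict l1 = λ ()
strictToU-nonstrict l0 = λ ()
strictToU-nonstrict lu = λ ()

strictToU-mono : k ≤ˡ k′ → strictToU k ≤ˡ strictToU k′
strictToU-mono ≤ˡ-refl = ≤ˡ-refl
strictToU-mono 1≤ˡu    = ≤ˡ-refl
strictToU-mono 0≤ˡu    = 0≤ˡu

erase-moveΔtoΓ : (Θ : Ctx n) → erase (moveΔtoΓ Θ) ≡ erase Θ
erase-moveΔtoΓ Θ = trans (sym (map-∘ _ _ Θ)) (map-cong (λ _ → refl) Θ)

erase-allToΓ : (Θ : Ctx n) → erase (allToΓ Θ) ≡ erase Θ
erase-allToΓ Θ = trans (sym (map-∘ _ _ Θ)) (map-cong (λ _ → refl) Θ)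

allToΓ-moveΔtoΓ : (Θ : Ctx n) → allToΓ (moveΔtoΓ Θ) ≡ allToΓ Θ
allToΓ-moveΔtoΓ Θ = trans (sym (map-∘ _ _ Θ)) (map-cong (λ _ → refl) Θ)

NoStrict-tail : NoStrict (x ∷ Θ) → NoStrict Θ
NoStrict-tail ns j = ns (suc j)

NoStrict-moveΔtoΓ : (Θ : Ctx n) → NoStrict (moveΔtoΓ Θ)
NoStrict-moveΔtoΓ ((k , _) ∷ _) zero    = strictToU-nonstrict k
NoStrict-moveΔtoΓ (_ ∷ Θ)       (suc j) = NoStrict-moveΔtoΓ Θ j

NoStrict-allToΓ : (Θ : Ctx n) → NoStrict (allToΓ Θ)
NoStrict-allToΓ (_ ∷ _) zero    = λ ()
NoStrict-allToΓ (_ ∷ Θ) (suc j) = NoStrict-allToΓ Θ j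

moveΔtoΓ-NoStrict : NoStrict Θ → moveΔtoΓ Θ ≡ Θ
moveΔtoΓ-NoStrict {Θ = []}            ns = refl
moveΔtoΓ-NoStrict {Θ = (l1 , _) ∷ _} ns = ⊥-elim (ns zero refl)
moveΔtoΓ-NoStrict {Θ = (l0 , _) ∷ _} ns = cong (_ ∷_) (moveΔtoΓ-NoStrict (NoStrict-tail ns))
moveΔtoΓ-NoStrict {Θ = (lu , _) ∷ _} ns = cong (_ ∷_) (moveΔtoΓ-NoStrict (NoStrict-tail ns))

OnlyStrict⇒NoStrict : OnlyStrict i Ψ → lookup Ψ i ≡ (lu , A) → NoStrict Ψ
OnlyStrict⇒NoStrict {i = i} os decl j with j ≟ i
... | yes refl rewrite decl = λ ()
... | no j≢i           = os j j≢i

split-swap : Split Θ ΘM ΘN → Split Θ ΘN ΘM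
split-swap []          = []
split-swap (sU sp)     = sU (split-swap sp)
split-swap (s0 sp)     = s0 (split-swap sp)
split-swap (sLeft sp)  = sRight (split-swap sp)
split-swap (sRight sp) = sLeft (split-swap sp)

split-mapˡ : {X : Set} (f : Lbl × Ty → X) → (∀ A → f (l1 , A) ≡ f (lu , A)) →
             Split Θ ΘM ΘN → map f ΘM ≡ map f Θ
split-mapˡ f f1≡fu []          = refl
split-mapˡ f f1≡fu (sU sp)     = cong (_ ∷_) (split-mapˡ f f1≡fu sp)
split-mapˡ f f1≡fu (s0 sp)     = cong (_ ∷_) (split-mapˡ f f1≡fu sp)
split-mapˡ f f1≡fu (sLeft sp)  = cong (_ ∷_) (split-mapˡ f f1≡fu sp)
split-mapˡ f f1≡fu (sRight {A = A} sp) =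
  cong₂ _∷_ (sym (f1≡fu A)) (split-mapˡ f f1≡fu sp)

erase-splitˡ : Split Θ ΘM ΘN → erase Θ ≡ erase ΘM
erase-splitˡ sp = sym (split-mapˡ _ (λ _ → refl) sp)

erase-splitʳ : Split Θ ΘM ΘN → erase Θ ≡ erase ΘN
erase-splitʳ sp = erase-splitˡ (split-swap sp)

split-moveΔtoΓˡ : Split Θ ΘM ΘN → moveΔtoΓ ΘM ≡ moveΔtoΓ Θ
split-moveΔtoΓˡ = split-mapˡ _ (λ _ → refl)

split-moveΔtoΓʳ : Split Θ ΘM ΘN → moveΔtoΓ ΘN ≡ moveΔtoΓ Θ
split-moveΔtoΓʳ sp = split-moveΔtoΓˡ (split-swap sp)

split-allToΓˡ : Split Θ ΘM ΘN → allToΓ ΘM ≡ allToΓ Θ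
split-allToΓˡ = split-mapˡ _ (λ _ → refl)

split-allToΓʳ : Split Θ ΘM ΘN → allToΓ ΘN ≡ allToΓ Θ
split-allToΓʳ sp = split-allToΓˡ (split-swap sp)

split-NoStrictˡ : Split Θ ΘM ΘN → NoStrict ΘM → ΘN ≡ Θ
split-NoStrictˡ []          ns = refl
split-NoStrictˡ (sU sp)     ns = cong (_ ∷_) (split-NoStrictˡ sp (NoStrict-tail ns))
split-NoStrictˡ (s0 sp)     ns = cong (_ ∷_) (split-NoStrictˡ sp (NoStrict-tail ns))
split-NoStrictˡ (sLeft sp)  ns = ⊥-elim (ns zero refl)
split-NoStrictˡ (sRight sp) ns = cong (_ ∷_) (split-NoStrictˡ sp (NoStrict-tail ns))

split-allLeft : (Θ : Ctx n) → Split Θ Θ (moveΔtoΓ Θ)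
split-allLeft []             = []
split-allLeft ((l1 , _) ∷ Θ) = sLeft (split-allLeft Θ)
split-allLeft ((l0 , _) ∷ Θ) = s0 (split-allLeft Θ)
split-allLeft ((lu , _) ∷ Θ) = sU (split-allLeft Θ)

split-assocˡ : Split Θ ΘM ΘN → Split ΘM Ψ Ψ′ → ∃[ Φ ] (Split Θ Φ Ψ′ × Split Φ Ψ ΘN)
split-assocˡ [] [] = [] , [] , []
split-assocˡ (sU s) (sU t) with split-assocˡ s t
... | _ , s′ , t′ = _ , sU s′ , sU t′
split-assocˡ (s0 s) (s0 t) with split-assocˡ s t
... | _ , s′ , t′ = _ , s0 s′ , s0 t′
split-assocˡ (sLeft s) (sLeft t) with split-assocˡ s t
... | _ , s′ , t′ = _ , sLeft s′ , sLeft t′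
split-assocˡ (sLeft s) (sRight t) with split-assocˡ s t
... | _ , s′ , t′ = _ , sRight s′ , sU t′
split-assocˡ (sRight s) (sU t) with split-assocˡ s t
... | _ , s′ , t′ = _ , sLeft s′ , sRight t′

split-assocʳ : Split Θ ΘM ΘN → Split ΘM Ψ Ψ′ → ∃[ Φ ] (Split Θ Ψ Φ × Split Φ Ψ′ ΘN)
split-assocʳ s t with split-assocˡ s (split-swap t)
... | Φ , s′ , t′ = Φ , split-swap s′ , t′

data Thinning : ℕ → ℕ → Set where
  done : Thinning 0 0
  keep : Thinning m n → Thinning (suc m) (suc n)
  skip : Thinning m n → Thinning m (suc n)

private variable
  θ : Thinning m n

toRen : Thinning m n → Ren m n
toRen (keep θ)   = extR (toRen θ)
toRen (skip θ) i = suc (toRen θ i)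

idᵗ : Thinning n n
idᵗ {n = 0}     = done
idᵗ {n = suc n} = keep idᵗ

toRen-id : (i : Fin n) → toRen idᵗ i ≡ i
toRen-id zero    = refl
toRen-id (suc i) = cong suc (toRen-id i)

ren-cong : {ρ ρ′ : Ren m n} → (∀ i → ρ i ≡ ρ′ i) → (M : Tm m) → ren ρ M ≡ ren ρ′ M
ren-cong ρ≗ρ′ (con c)     = refl
ren-cong ρ≗ρ′ (var i)     = cong var (ρ≗ρ′ i)
ren-cong {ρ = ρ} {ρ′} ρ≗ρ′ (lam k A M) = cong (lam k A) (ren-cong extR≗ M)
  where extR≗ : ∀ i → extR ρ i ≡ extR ρ′ i
        extR≗ zero    = refl
        extR≗ (suc i) = cong suc (ρ≗ρ′ i)
ren-cong ρ≗ρ′ (app M N k) = cong₂ (λ M N → app M N k) (ren-cong ρ≗ρ′ M) (ren-cong ρ≗ρ′ N)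

ren-id : {ρ : Ren n n} → (∀ i → ρ i ≡ i) → (M : Tm n) → ren ρ M ≡ M
ren-id ρ≗id (con c)     = refl
ren-id ρ≗id (var i)     = cong var (ρ≗id i)
ren-id {ρ = ρ} ρ≗id (lam k A M) = cong (lam k A) (ren-id extR≗id M)
  where extR≗id : ∀ i → extR ρ i ≡ i
        extR≗id zero    = refl
        extR≗id (suc i) = cong suc (ρ≗id i)
ren-id ρ≗id (app M N k) = cong₂ (λ M N → app M N k) (ren-id ρ≗id M) (ren-id ρ≗id N)

data _⊑[_]_ : Ctx m → Thinning m n → Ctx n → Set where
  []   : [] ⊑[ done ] []
  keep : k ≤ˡ k′ → Φ ⊑[ θ ] Ψ →
         ((k , A) ∷ Φ) ⊑[ keep θ ] ((k′ , A) ∷ Ψ)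
  skip : k ≢ l1 → Φ ⊑[ θ ] Ψ →
         Φ ⊑[ skip θ ] ((k , A) ∷ Ψ)

⊑-refl : (Θ : Ctx n) → Θ ⊑[ idᵗ ] Θ
⊑-refl []      = []
⊑-refl (_ ∷ Θ) = keep ≤ˡ-refl (⊑-refl Θ)

⊑-moveΔtoΓ : (Θ : Ctx n) → Θ ⊑[ idᵗ ] moveΔtoΓ Θ
⊑-moveΔtoΓ []             = []
⊑-moveΔtoΓ ((l1 , _) ∷ Θ) = keep 1≤ˡu (⊑-moveΔtoΓ Θ)
⊑-moveΔtoΓ ((l0 , _) ∷ Θ) = keep ≤ˡ-refl (⊑-moveΔtoΓ Θ)
⊑-moveΔtoΓ ((lu , _) ∷ Θ) = keep ≤ˡ-refl (⊑-moveΔtoΓ Θ)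

⊑-allToΓ : (Θ : Ctx n) → Θ ⊑[ idᵗ ] allToΓ Θ
⊑-allToΓ []             = []
⊑-allToΓ ((k , _) ∷ Θ) = keep (≤ˡ-lu k) (⊑-allToΓ Θ)

⊑-lookup : Φ ⊑[ θ ] Ψ → lookup Φ i ≡ (k , A) →
           ∃[ k′ ] (k ≤ˡ k′ × lookup Ψ (toRen θ i) ≡ (k′ , A))
⊑-lookup {i = zero}  (keep {k′ = k′} k≤k′ _) refl = k′ , k≤k′ , refl
⊑-lookup {i = suc i} (keep _ e) decl = ⊑-lookup e decl
⊑-lookup             (skip _ e) decl = ⊑-lookup e decl

⊑-NoStrict : Φ ⊑[ θ ] Ψ → NoStrict Φ → NoStrict Ψ
⊑-NoStrict (keep k≤k′ e) ns zero    = ≤ˡ-nonstrict k≤k′ (ns zero)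
⊑-NoStrict (keep k≤k′ e) ns (suc j) = ⊑-NoStrict e (NoStrict-tail ns) j
⊑-NoStrict (skip k≢l1 e) ns zero    = k≢l1
⊑-NoStrict (skip k≢l1 e) ns (suc j) = ⊑-NoStrict e ns j

⊑-OnlyStrict : Φ ⊑[ θ ] Ψ → OnlyStrict i Φ → OnlyStrict (toRen θ i) Ψ
⊑-OnlyStrict {i = zero}  (keep _ e) os zero    0≢0 = ⊥-elim (0≢0 refl)
⊑-OnlyStrict {i = zero}  (keep _ e) os (suc j) _   =
  ⊑-NoStrict e (λ j → os (suc j) (λ ())) j
⊑-OnlyStrict {i = suc i} (keep k≤k′ e) os zero _   = ≤ˡ-nonstrict k≤k′ (os zero (λ ()))
⊑-OnlyStrict {i = suc i} (keep _ e) os (suc j) j≢i =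
  ⊑-OnlyStrict e (λ j′ j′≢i → os (suc j′) (λ eq → j′≢i (suc-injective eq))) j
    (λ eq → j≢i (cong suc eq))
⊑-OnlyStrict (skip k≢l1 e) os zero    _   = k≢l1
⊑-OnlyStrict (skip _ e)    os (suc j) j≢i = ⊑-OnlyStrict e os j (λ eq → j≢i (cong suc eq))

⊑-moveΔtoΓ-mono : Φ ⊑[ θ ] Ψ → moveΔtoΓ Φ ⊑[ θ ] moveΔtoΓ Ψ
⊑-moveΔtoΓ-mono [] = []
⊑-moveΔtoΓ-mono (keep k≤k′ e) = keep (strictToU-mono k≤k′) (⊑-moveΔtoΓ-mono e)
⊑-moveΔtoΓ-mono (skip {k = k} _ e) = skip (strictToU-nonstrict k) (⊑-moveΔtoΓ-mono e)

⊑-allToΓ-mono : Φ ⊑[ θ ] Ψ → allToΓ Φ ⊑[ θ ] allToΓ Ψ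
⊑-allToΓ-mono []         = []
⊑-allToΓ-mono (keep _ e) = keep ≤ˡ-refl (⊑-allToΓ-mono e)
⊑-allToΓ-mono (skip _ e) = skip (λ ()) (⊑-allToΓ-mono e)

⊑-split : Φ ⊑[ θ ] Ψ → Split Φ ΨM ΨN →
          ∃[ Ψ₁ ] ∃[ Ψ₂ ] (Split Ψ Ψ₁ Ψ₂ × ΨM ⊑[ θ ] Ψ₁ × ΨN ⊑[ θ ] Ψ₂)
⊑-split [] [] = [] , [] , [] , [] , []
⊑-split (keep ≤ˡ-refl e) (sU sp) with ⊑-split e sp
... | _ , _ , sp′ , eM , eN = _ , _ , sU sp′ , keep ≤ˡ-refl eM , keep ≤ˡ-refl eN
⊑-split (keep ≤ˡ-refl e) (s0 sp) with ⊑-split e sp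
... | _ , _ , sp′ , eM , eN = _ , _ , s0 sp′ , keep ≤ˡ-refl eM , keep ≤ˡ-refl eN
⊑-split (keep 0≤ˡu e) (s0 sp) with ⊑-split e sp
... | _ , _ , sp′ , eM , eN = _ , _ , sU sp′ , keep 0≤ˡu eM , keep 0≤ˡu eN
⊑-split (keep ≤ˡ-refl e) (sLeft sp) with ⊑-split e sp
... | _ , _ , sp′ , eM , eN = _ , _ , sLeft sp′ , keep ≤ˡ-refl eM , keep ≤ˡ-refl eN
⊑-split (keep 1≤ˡu e) (sLeft sp) with ⊑-split e sp
... | _ , _ , sp′ , eM , eN = _ , _ , sU sp′ , keep 1≤ˡu eM , keep ≤ˡ-refl eN
⊑-split (keep ≤ˡ-refl e) (sRight sp) with ⊑-split e sp
... | _ , _ , sp′ , eM , eN = _ , _ , sRight sp′ , keep ≤ˡ-refl eM , keep ≤ˡ-refl eN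
⊑-split (keep 1≤ˡu e) (sRight sp) with ⊑-split e sp
... | _ , _ , sp′ , eM , eN = _ , _ , sU sp′ , keep ≤ˡ-refl eM , keep 1≤ˡu eN
⊑-split (skip {k = lu} k≢l1 e) sp with ⊑-split e sp
... | _ , _ , sp′ , eM , eN = _ , _ , sU sp′ , skip k≢l1 eM , skip k≢l1 eN
⊑-split (skip {k = l0} k≢l1 e) sp with ⊑-split e sp
... | _ , _ , sp′ , eM , eN = _ , _ , s0 sp′ , skip k≢l1 eM , skip k≢l1 eN
⊑-split (skip {k = l1} k≢l1 e) sp = ⊥-elim (k≢l1 refl)

-- Under a binder the substituted variable leaves position zero, so substitution is
-- stated for a declaration inserted at an arbitrary position p.
data Insert (x : Lbl × Ty) : {n : ℕ} → Fin (suc n) → Ctx n → Ctx (suc n) → Set where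
  here  : Insert x zero Θ (x ∷ Θ)
  there : Insert x p Θ Ξ → Insert x (suc p) (y ∷ Θ) (y ∷ Ξ)

Insert-lookup : Insert x p Θ Ξ → lookup Ξ p ≡ x
Insert-lookup here        = refl
Insert-lookup (there ins) = Insert-lookup ins

Insert-punchIn : Insert x p Θ Ξ → ∀ j → lookup Ξ (punchIn p j) ≡ lookup Θ j
Insert-punchIn here        j       = refl
Insert-punchIn (there ins) zero    = refl
Insert-punchIn (there ins) (suc j) = Insert-punchIn ins j

Insert-moveΔtoΓ : Insert (k , A) p Θ Ξ → Insert (strictToU k , A) p (moveΔtoΓ Θ) (moveΔtoΓ Ξ)
Insert-moveΔtoΓ here        = here
Insert-moveΔtoΓ (there ins) = there (Insert-moveΔtoΓ ins)

Insert-allToΓ : Insert x p Θ Ξ → Insert (lu , proj₂ x) p (allToΓ Θ) (allToΓ Ξ)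
Insert-allToΓ here        = here
Insert-allToΓ (there ins) = there (Insert-allToΓ ins)

Insert-NoStrict : Insert x p Θ Ξ → NoStrict Ξ → NoStrict Θ
Insert-NoStrict {p = p} ins ns j =
  subst (λ d → proj₁ d ≢ l1) (Insert-punchIn ins j) (ns (punchIn p j))

Insert-OnlyStrict : Insert x p Θ Ξ → OnlyStrict (punchIn p i) Ξ → OnlyStrict i Θ
Insert-OnlyStrict {p = p} {i = i} ins os j j≢i =
  subst (λ d → proj₁ d ≢ l1) (Insert-punchIn ins j)
    (os (punchIn p j) (λ eq → j≢i (punchIn-injective p j i eq)))

Insert-OnlyStrict-here : Insert x p Θ Ξ → OnlyStrict p Ξ → NoStrict Θ
Insert-OnlyStrict-here {p = p} ins os j =
  subst (λ d → proj₁ d ≢ l1) (Insert-punchIn ins j) (os (punchIn p j) (punchInᵢ≢i p j))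

Insert-strict-¬NoStrict : Insert (l1 , A) p Θ Ξ → NoStrict Ξ → ⊥
Insert-strict-¬NoStrict {p = p} ins ns = ns p (cong proj₁ (Insert-lookup ins))

Insert-strict-¬OnlyStrict : Insert (l1 , A) p Θ Ξ → OnlyStrict (punchIn p i) Ξ → ⊥
Insert-strict-¬OnlyStrict {p = p} {i = i} ins os =
  os p (λ eq → punchInᵢ≢i p i (sym eq)) (cong proj₁ (Insert-lookup ins))

SplitDecl : (x xM xN : Lbl × Ty) → Set
SplitDecl x xM xN = Split (x ∷ []) (xM ∷ []) (xN ∷ [])

Insert-split : Insert x p Θ Ξ → Split Ξ ΞM ΞN →
  ∃[ xM ] ∃[ xN ] ∃[ ΘM ] ∃[ ΘN ]
    (SplitDecl x xM xN × Split Θ ΘM ΘN × Insert xM p ΘM ΞM × Insert xN p ΘN ΞN)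
Insert-split here (sU sp)     = _ , _ , _ , _ , sU [] , sp , here , here
Insert-split here (s0 sp)     = _ , _ , _ , _ , s0 [] , sp , here , here
Insert-split here (sLeft sp)  = _ , _ , _ , _ , sLeft [] , sp , here , here
Insert-split here (sRight sp) = _ , _ , _ , _ , sRight [] , sp , here , here
Insert-split (there ins) (sU sp) with Insert-split ins sp
... | _ , _ , _ , _ , d , sp′ , iM , iN = _ , _ , _ , _ , d , sU sp′ , there iM , there iN
Insert-split (there ins) (s0 sp) with Insert-split ins sp
... | _ , _ , _ , _ , d , sp′ , iM , iN = _ , _ , _ , _ , d , s0 sp′ , there iM , there iN
Insert-split (there ins) (sLeft sp) with Insert-split ins sp
... | _ , _ , _ , _ , d , sp′ , iM , iN = _ , _ , _ , _ , d , sLeft sp′ , there iM , there iN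
Insert-split (there ins) (sRight sp) with Insert-split ins sp
... | _ , _ , _ , _ , d , sp′ , iM , iN = _ , _ , _ , _ , d , sRight sp′ , there iM , there iN

data PunchView (p : Fin (suc n)) : Fin (suc n) → Set where
  at      : PunchView p p
  punched : ∀ j → PunchView p (punchIn p j)

punchView : (p i : Fin (suc n)) → PunchView p i
punchView zero    zero    = at
punchView zero    (suc j) = punched j
punchView {n = suc n} (suc p) zero = punched zero
punchView {n = suc n} (suc p) (suc i) with punchView p i
... | at        = at
... | punched j = punched (suc j)

record SubstAt (p : Fin (suc n)) (N : Tm n) (σ : Subst (suc n) n) : Set where
  constructor substAt
  field
    hit  : σ p ≡ N
    miss : ∀ j → σ (punchIn p j) ≡ var j

SubstAt-extS : SubstAt p N σ → SubstAt (suc p) (weaken N) (extS σ)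
SubstAt-extS (substAt hit miss) = substAt (cong weaken hit) λ where
  zero    → refl
  (suc j) → cong weaken (miss j)

SubstAt-single : (N : Tm n) → SubstAt zero N (single N)
SubstAt-single N = substAt refl (λ _ → refl)

module _ {Σ : Sig} where

  ⊢-cast : Θ ≡ Ψ → Σ ∣ Θ ⊢ M ∶ A → Σ ∣ Ψ ⊢ M ∶ A
  ⊢-cast = subst (Σ ∣_⊢ _ ∶ _)

  ⊢-rename : Φ ⊑[ θ ] Ψ → Σ ∣ Φ ⊢ M ∶ A → Σ ∣ Ψ ⊢ ren (toRen θ) M ∶ A
  ⊢-rename e (t-con c ns) = t-con c (⊑-NoStrict e ns)
  ⊢-rename e (t-varU decl ns) with ⊑-lookup e decl
  ... | _ , ≤ˡ-refl , decl′ = t-varU decl′ (⊑-NoStrict e ns)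
  ⊢-rename {Ψ = Ψ} e (t-varS decl os) with ⊑-lookup e decl
  ... | _ , ≤ˡ-refl , decl′ = t-varS decl′ (⊑-OnlyStrict e os)
  ... | _ , 1≤ˡu    , decl′ =
    t-varU decl′ (OnlyStrict⇒NoStrict {Ψ = Ψ} (⊑-OnlyStrict e os) decl′)
  ⊢-rename e (t-lamU D) = t-lamU (⊢-rename (keep ≤ˡ-refl e) D)
  ⊢-rename e (t-lam0 D) = t-lam0 (⊢-rename (keep ≤ˡ-refl e) D)
  ⊢-rename e (t-lam1 D) = t-lam1 (⊢-rename (keep ≤ˡ-refl e) D)
  ⊢-rename e (t-appU D E) = t-appU (⊢-rename e D) (⊢-rename (⊑-moveΔtoΓ-mono e) E)
  ⊢-rename e (t-app0 D E) = t-app0 (⊢-rename e D) (⊢-rename (⊑-allToΓ-mono e) E)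
  ⊢-rename e (t-app1 sp D E) with ⊑-split e sp
  ... | _ , _ , sp′ , eM , eN = t-app1 sp′ (⊢-rename eM D) (⊢-rename eN E)

  ⊢-relabel : Θ ⊑[ idᵗ ] Ψ → Σ ∣ Θ ⊢ M ∶ A → Σ ∣ Ψ ⊢ M ∶ A
  ⊢-relabel {M = M} e D = subst (λ M → Σ ∣ _ ⊢ M ∶ _) (ren-id toRen-id M) (⊢-rename e D)

  ⊢-moveΔtoΓ : Σ ∣ Θ ⊢ M ∶ A → Σ ∣ moveΔtoΓ Θ ⊢ M ∶ A
  ⊢-moveΔtoΓ = ⊢-relabel (⊑-moveΔtoΓ _)

  ⊢-allToΓ : Σ ∣ Θ ⊢ M ∶ A → Σ ∣ allToΓ Θ ⊢ M ∶ A
  ⊢-allToΓ = ⊢-relabel (⊑-allToΓ _)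

  ⊢-weaken : k ≢ l1 → Σ ∣ Θ ⊢ M ∶ A → Σ ∣ (k , B) ∷ Θ ⊢ weaken M ∶ A
  ⊢-weaken {M = M} k≢l1 D =
    subst (λ M → Σ ∣ _ ⊢ M ∶ _) (ren-cong (λ i → cong suc (toRen-id i)) M)
      (⊢-rename (skip k≢l1 (⊑-refl _)) D)

  ⊢-moveΔtoΓ-allToΓ : Σ ∣ moveΔtoΓ Θ ⊢ M ∶ A → Σ ∣ moveΔtoΓ (allToΓ Θ) ⊢ M ∶ A
  ⊢-moveΔtoΓ-allToΓ {Θ = Θ} D = ⊢-moveΔtoΓ (⊢-cast (allToΓ-moveΔtoΓ Θ) (⊢-allToΓ D))

  ⊢-moveΔtoΓ-resplit : Split Θ ΘM ΘN → moveΔtoΓ Ψ ≡ moveΔtoΓ Θ →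
                       Σ ∣ ΘN ⊢ M ∶ A → Σ ∣ moveΔtoΓ Ψ ⊢ M ∶ A
  ⊢-moveΔtoΓ-resplit sp Ψ≈Θ D =
    ⊢-cast (trans (split-moveΔtoΓʳ sp) (sym Ψ≈Θ)) (⊢-moveΔtoΓ D)

  ⊢-subst-punched : Insert x p Θ Ξ → SubstAt p N σ →
                    Σ ∣ Ξ ⊢ var (punchIn p i) ∶ B → Σ ∣ Θ ⊢ σ (punchIn p i) ∶ B
  ⊢-subst-punched {i = i} ins (substAt _ miss) (t-varU decl ns) rewrite miss i =
    t-varU (trans (sym (Insert-punchIn ins i)) decl) (Insert-NoStrict ins ns)
  ⊢-subst-punched {i = i} ins (substAt _ miss) (t-varS decl os) rewrite miss i =
    t-varS (trans (sym (Insert-punchIn ins i)) decl) (Insert-OnlyStrict ins os)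

  ⊢-subst-u : Insert (lu , A) p Θ Ξ → Σ ∣ moveΔtoΓ Θ ⊢ N ∶ A → SubstAt p N σ →
              Σ ∣ Ξ ⊢ M ∶ B → Σ ∣ Θ ⊢ sub σ M ∶ B
  ⊢-subst-u ins ⊢N σ-at (t-con c ns) = t-con c (Insert-NoStrict ins ns)
  ⊢-subst-u {p = p} ins ⊢N σ-at D@(t-varU {i = i} decl ns) with punchView p i
  ... | punched j = ⊢-subst-punched ins σ-at D
  ... | at with trans (sym (Insert-lookup ins)) decl
  ...   | refl rewrite SubstAt.hit σ-at =
    ⊢-cast (moveΔtoΓ-NoStrict (Insert-NoStrict ins ns)) ⊢N
  ⊢-subst-u {p = p} ins ⊢N σ-at D@(t-varS {i = i} decl os) with punchView p i
  ... | punched j = ⊢-subst-punched ins σ-at D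
  ... | at with trans (sym (Insert-lookup ins)) decl
  ...   | ()
  ⊢-subst-u ins ⊢N σ-at (t-lamU D) =
    t-lamU (⊢-subst-u (there ins) (⊢-weaken (λ ()) ⊢N) (SubstAt-extS σ-at) D)
  ⊢-subst-u ins ⊢N σ-at (t-lam0 D) =
    t-lam0 (⊢-subst-u (there ins) (⊢-weaken (λ ()) ⊢N) (SubstAt-extS σ-at) D)
  ⊢-subst-u ins ⊢N σ-at (t-lam1 D) =
    t-lam1 (⊢-subst-u (there ins) (⊢-weaken (λ ()) ⊢N) (SubstAt-extS σ-at) D)
  ⊢-subst-u ins ⊢N σ-at (t-appU D E) =
    t-appU (⊢-subst-u ins ⊢N σ-at D) (⊢-subst-u (Insert-moveΔtoΓ ins) (⊢-moveΔtoΓ ⊢N) σ-at E)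
  ⊢-subst-u ins ⊢N σ-at (t-app0 D E) =
    t-app0 (⊢-subst-u ins ⊢N σ-at D)
      (⊢-subst-u (Insert-allToΓ ins) (⊢-moveΔtoΓ-allToΓ ⊢N) σ-at E)
  ⊢-subst-u ins ⊢N σ-at (t-app1 sp D E) with Insert-split ins sp
  ... | _ , _ , _ , _ , sU [] , sp′ , iM , iN =
    t-app1 sp′ (⊢-subst-u iM (⊢-cast (sym (split-moveΔtoΓˡ sp′)) ⊢N) σ-at D)
               (⊢-subst-u iN (⊢-cast (sym (split-moveΔtoΓʳ sp′)) ⊢N) σ-at E)

  ⊢-subst-0 : Insert (l0 , A) p Θ Ξ → Σ ∣ allToΓ Θ ⊢ N ∶ A → SubstAt p N σ →
              Σ ∣ Ξ ⊢ M ∶ B → Σ ∣ Θ ⊢ sub σ M ∶ B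
  ⊢-subst-0 ins ⊢N σ-at (t-con c ns) = t-con c (Insert-NoStrict ins ns)
  ⊢-subst-0 {p = p} ins ⊢N σ-at D@(t-varU {i = i} decl ns) with punchView p i
  ... | punched j = ⊢-subst-punched ins σ-at D
  ... | at with trans (sym (Insert-lookup ins)) decl
  ...   | ()
  ⊢-subst-0 {p = p} ins ⊢N σ-at D@(t-varS {i = i} decl os) with punchView p i
  ... | punched j = ⊢-subst-punched ins σ-at D
  ... | at with trans (sym (Insert-lookup ins)) decl
  ...   | ()
  ⊢-subst-0 ins ⊢N σ-at (t-lamU D) =
    t-lamU (⊢-subst-0 (there ins) (⊢-weaken (λ ()) ⊢N) (SubstAt-extS σ-at) D)
  ⊢-subst-0 ins ⊢N σ-at (t-lam0 D) =
    t-lam0 (⊢-subst-0 (there ins) (⊢-weaken (λ ()) ⊢N) (SubstAt-extS σ-at) D)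
  ⊢-subst-0 ins ⊢N σ-at (t-lam1 D) =
    t-lam1 (⊢-subst-0 (there ins) (⊢-weaken (λ ()) ⊢N) (SubstAt-extS σ-at) D)
  ⊢-subst-0 {Θ = Θ} ins ⊢N σ-at (t-appU D E) =
    t-appU (⊢-subst-0 ins ⊢N σ-at D) (⊢-subst-0 (Insert-moveΔtoΓ ins) ⊢N′ σ-at E)
    where ⊢N′ : Σ ∣ allToΓ (moveΔtoΓ Θ) ⊢ _ ∶ _
          ⊢N′ = ⊢-cast (sym (allToΓ-moveΔtoΓ Θ)) ⊢N
  ⊢-subst-0 ins ⊢N σ-at (t-app0 D E) =
    t-app0 (⊢-subst-0 ins ⊢N σ-at D) (⊢-subst-u (Insert-allToΓ ins) (⊢-moveΔtoΓ ⊢N) σ-at E)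
  ⊢-subst-0 ins ⊢N σ-at (t-app1 sp D E) with Insert-split ins sp
  ... | _ , _ , _ , _ , s0 [] , sp′ , iM , iN =
    t-app1 sp′ (⊢-subst-0 iM (⊢-cast (sym (split-allToΓˡ sp′)) ⊢N) σ-at D)
               (⊢-subst-0 iN (⊢-cast (sym (split-allToΓʳ sp′)) ⊢N) σ-at E)

  -- As in the strict application rule: x belongs to the part ΘM used by M, while N is
  -- typed in the complementary part ΘN.
  ⊢-subst-1 : Insert (l1 , A) p ΘM Ξ → Split Θ ΘM ΘN → Σ ∣ ΘN ⊢ N ∶ A → SubstAt p N σ →
              Σ ∣ Ξ ⊢ M ∶ B → Σ ∣ Θ ⊢ sub σ M ∶ B
  ⊢-subst-1 ins sp ⊢N σ-at (t-con c ns)     = ⊥-elim (Insert-strict-¬NoStrict ins ns)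
  ⊢-subst-1 ins sp ⊢N σ-at (t-varU decl ns) = ⊥-elim (Insert-strict-¬NoStrict ins ns)
  ⊢-subst-1 {p = p} ins sp ⊢N σ-at (t-varS {i = i} decl os) with punchView p i
  ... | punched j = ⊥-elim (Insert-strict-¬OnlyStrict ins os)
  ... | at with trans (sym (Insert-lookup ins)) decl
  ...   | refl rewrite SubstAt.hit σ-at =
    ⊢-cast (split-NoStrictˡ sp (Insert-OnlyStrict-here ins os)) ⊢N
  ⊢-subst-1 ins sp ⊢N σ-at (t-lamU D) =
    t-lamU (⊢-subst-1 (there ins) (sU sp) (⊢-weaken (λ ()) ⊢N) (SubstAt-extS σ-at) D)
  ⊢-subst-1 ins sp ⊢N σ-at (t-lam0 D) =
    t-lam0 (⊢-subst-1 (there ins) (s0 sp) (⊢-weaken (λ ()) ⊢N) (SubstAt-extS σ-at) D)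
  ⊢-subst-1 ins sp ⊢N σ-at (t-lam1 D) =
    t-lam1 (⊢-subst-1 (there ins) (sLeft sp) (⊢-weaken (λ ()) ⊢N) (SubstAt-extS σ-at) D)
  ⊢-subst-1 ins sp ⊢N σ-at (t-appU D E) =
    t-appU (⊢-subst-1 ins sp ⊢N σ-at D)
      (⊢-cast (split-moveΔtoΓˡ sp)
        (⊢-subst-u (Insert-moveΔtoΓ ins)
          (⊢-moveΔtoΓ (⊢-moveΔtoΓ-resplit sp (split-moveΔtoΓˡ sp) ⊢N)) σ-at E))
  ⊢-subst-1 ins sp ⊢N σ-at (t-app0 D E) =
    t-app0 (⊢-subst-1 ins sp ⊢N σ-at D)
      (⊢-cast (split-allToΓˡ sp)
        (⊢-subst-u (Insert-allToΓ ins)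
          (⊢-moveΔtoΓ-allToΓ (⊢-moveΔtoΓ-resplit sp (split-moveΔtoΓˡ sp) ⊢N)) σ-at E))
  ⊢-subst-1 ins sp ⊢N σ-at (t-app1 spD D E) with Insert-split ins spD
  ... | _ , _ , _ , _ , sLeft [] , spM , iM , iN =
    let _ , sp′ , spM′ = split-assocˡ sp spM
    in t-app1 sp′ (⊢-subst-1 iM spM′ ⊢N σ-at D)
         (⊢-subst-u iN (⊢-moveΔtoΓ-resplit sp (split-moveΔtoΓʳ sp′) ⊢N) σ-at E)
  ... | _ , _ , _ , _ , sRight [] , spM , iM , iN =
    let _ , sp′ , spN′ = split-assocʳ sp spM
    in t-app1 sp′ (⊢-subst-u iM (⊢-moveΔtoΓ-resplit sp (split-moveΔtoΓˡ sp′) ⊢N) σ-at D)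
                  (⊢-subst-1 iN spN′ ⊢N σ-at E)

  ⊢-η-body : Σ ∣ Ψ ⊢ M ∶ A ⟶[ k ] B → Σ ∣ (k , A) ∷ Ψ ⊢ app (weaken M) (var zero) k ∶ B
  ⊢-η-body {Ψ = Ψ} {A = A} {k = lu} D =
    t-appU (⊢-weaken (λ ()) D) (t-varU refl (NoStrict-moveΔtoΓ ((lu , A) ∷ Ψ)))
  ⊢-η-body {Ψ = Ψ} {A = A} {k = l0} D =
    t-app0 (⊢-weaken (λ ()) D) (t-varU refl (NoStrict-allToΓ ((l0 , A) ∷ Ψ)))
  ⊢-η-body {Ψ = Ψ} {A = A} {k = l1} D =
    t-app1 (sRight (split-allLeft Ψ)) (⊢-weaken (λ ()) D) (t-varS refl x-only)
    where x-only : OnlyStrict zero ((l1 , A) ∷ moveΔtoΓ Ψ)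
          x-only zero    0≢0 = ⊥-elim (0≢0 refl)
          x-only (suc j) _   = NoStrict-moveΔtoΓ Ψ j

  c-lam : Σ ∣ (k , A) ∷ Ψ ⊢ M ⇑ B → Σ ∣ Ψ ⊢ lam k A M ⇑ A ⟶[ k ] B
  c-lam {k = lu} = c-lamU
  c-lam {k = l0} = c-lam0
  c-lam {k = l1} = c-lam1

  whr-subject-reduction : M ⟶whr M′ → Σ ∣ Ψ ⊢ M ∶ A → Σ ∣ Ψ ⊢ M′ ∶ A
  whr-subject-reduction whr-β (t-appU (t-lamU D) E)    = ⊢-subst-u here E (SubstAt-single _) D
  whr-subject-reduction whr-β (t-app0 (t-lam0 D) E)    = ⊢-subst-0 here E (SubstAt-single _) D
  whr-subject-reduction whr-β (t-app1 sp (t-lam1 D) E) =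
    ⊢-subst-1 here sp E (SubstAt-single _) D
  whr-subject-reduction (whr-app r) (t-appU D E)    = t-appU (whr-subject-reduction r D) E
  whr-subject-reduction (whr-app r) (t-app0 D E)    = t-app0 (whr-subject-reduction r D) E
  whr-subject-reduction (whr-app r) (t-app1 sp D E) = t-app1 sp (whr-subject-reduction r D) E

  ⊩↓-type-unique : Σ ∣ G ⊩ M ↓ N ∶ A → G ≡ erase Ψ → Σ ∣ Ψ ⊢ M ∶ B → A ≡ B
  ⊩↓-type-unique (cv-con c) _ (t-con c′ _) = just-injective (trans (sym c) c′)
  ⊩↓-type-unique {Ψ = Ψ} (cv-var {i = i} decl) refl (t-varU decl′ _) =
    trans (sym decl) (trans (lookup-map i proj₂ Ψ) (cong proj₂ decl′))
  ⊩↓-type-unique {Ψ = Ψ} (cv-var {i = i} decl) refl (t-varS decl′ _) =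
    trans (sym decl) (trans (lookup-map i proj₂ Ψ) (cong proj₂ decl′))
  ⊩↓-type-unique (cv-app d _) G≡ (t-appU D _) with ⊩↓-type-unique d G≡ D
  ... | refl = refl
  ⊩↓-type-unique (cv-app d _) G≡ (t-app0 D _) with ⊩↓-type-unique d G≡ D
  ... | refl = refl
  ⊩↓-type-unique (cv-app d _) G≡ (t-app1 sp D _)
    with ⊩↓-type-unique d (trans G≡ (erase-splitˡ sp)) D
  ... | refl = refl

  -- The conversion context G is kept apart from erase Ψ because the two parts of a Split
  -- have the same erasure as Ψ only propositionally.
  ⊩⇑-canonical : Σ ∣ G ⊩ M ⇑ N ∶ A → G ≡ erase Ψ → Σ ∣ Ψ ⊢ M ∶ A → Σ ∣ Ψ ⊢ N ⇑ A
  ⊩↓-atomic    : Σ ∣ G ⊩ M ↓ N ∶ A → G ≡ erase Ψ → Σ ∣ Ψ ⊢ M ∶ A → Σ ∣ Ψ ⊢ N ↓ A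

  ⊩⇑-canonical (cv-whr r d) G≡ D = ⊩⇑-canonical d G≡ (whr-subject-reduction r D)
  ⊩⇑-canonical (cv-atm d)   G≡ D = c-atm (⊩↓-atomic d G≡ D)
  ⊩⇑-canonical (cv-lam d) refl D = c-lam (⊩⇑-canonical d refl (⊢-η-body D))

  ⊩↓-atomic (cv-con _) _ (t-con c ns)     = a-con c ns
  ⊩↓-atomic (cv-var _) _ (t-varU decl ns) = a-varU decl ns
  ⊩↓-atomic (cv-var _) _ (t-varS decl os) = a-varS decl os
  ⊩↓-atomic {Ψ = Ψ} (cv-app d e) G≡ (t-appU D E) with ⊩↓-type-unique d G≡ D
  ... | refl = a-appU (⊩↓-atomic d G≡ D) (⊩⇑-canonical e (trans G≡ (sym (erase-moveΔtoΓ Ψ))) E)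
  ⊩↓-atomic {Ψ = Ψ} (cv-app d e) G≡ (t-app0 D E) with ⊩↓-type-unique d G≡ D
  ... | refl = a-app0 (⊩↓-atomic d G≡ D) (⊩⇑-canonical e (trans G≡ (sym (erase-allToΓ Ψ))) E)
  ⊩↓-atomic (cv-app d e) G≡ (t-app1 sp D E)
    with ⊩↓-type-unique d (trans G≡ (erase-splitˡ sp)) D
  ... | refl = a-app1 sp (⊩↓-atomic d (trans G≡ (erase-splitˡ sp)) D)
                         (⊩⇑-canonical e (trans G≡ (erase-splitʳ sp)) E)

theorem4p2 : (Σ : Sig) {n : ℕ} (Ψ : Ctx n) →
    ((M N : Tm n) (A : Ty) →
      Σ ∣ erase Ψ ⊩ M ⇑ N ∶ A → Σ ∣ Ψ ⊢ M ∶ A → Σ ∣ Ψ ⊢ N ⇑ A)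
  × ((M N : Tm n) (A : Ty) →
      Σ ∣ erase Ψ ⊩ M ↓ N ∶ A → Σ ∣ Ψ ⊢ M ∶ A → Σ ∣ Ψ ⊢ N ↓ A)
theorem4p2 Σ Ψ = (λ _ _ _ d D → ⊩⇑-canonical d refl D) , (λ _ _ _ d D → ⊩↓-atomic d refl D)
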